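{- Let $G$ be a cubic plane graph on $n$ vertices, and let $(W,B)$ be an improper stable-tree decomposition of $G$. Then $n=4k-2$ for some $k\in\mathbb{N}$, and moreover $|W|=k+1$.
   Context: An improper stable-tree decomposition of a cubic plane graph $G$ is a partition of $V(G)$ into two sets $W$ and $B$ such that $W$ is a stable (independent) set, the induced subgraph $G[B]$ is a forest with exactly three components, and there exists a hexagonal face of $G$ incident to exactly one vertex of each of the three components of $G[B]$. -}

module Defs where

open import Data.Nat using (ℕ; zero; suc; _+_; _*_; _≤_; _≤ᵇ_)
open import Data.Bool using (Bool; true; false; if_then_else_)
open import Data.Fin using (Fin; zero; suc; toℕ; inject₁; fromℕ)
open import Data.Product using (Σ; ∃; _×_; _,_; proj₁; proj₂)
open import Data.List using (List; allFin; upTo; map; concatMap)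
open import Data.Nat.ListAction using (sum)
open import Data.Bool.ListAction using (all)
open import Data.Unit using (⊤)
open import Relation.Binary.PropositionalEquality using (_≡_; _≢_)
open import Relation.Nullary using (¬_)
open import Function.Bundles using (_⇔_)

Dart : ℕ → Set
Dart n = Fin n × Fin 3

-- cyclic rotation of the three slots at a vertex (the rotation system)
rot : Fin 3 → Fin 3
rot zero = suc zero
rot (suc zero) = suc (suc zero)
rot (suc (suc zero)) = zero

-- A simple cubic graph given as a combinatorial map: the rotation at each
-- vertex is the cyclic order of its slots, α pairs darts into edges.
record CubicMap (n : ℕ) : Set where
  field
    α       : Dart n → Dart n
    α-invol : ∀ d → α (α d) ≡ d
    noLoop  : ∀ v i → proj₁ (α (v , i)) ≢ v
    noMulti : ∀ v i j → i ≢ j → proj₁ (α (v , i)) ≢ proj₁ (α (v , j))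
open CubicMap public

module _ {n : ℕ} (G : CubicMap n) where

  Adj : Fin n → Fin n → Set
  Adj u v = ∃ λ i → proj₁ (α G (u , i)) ≡ v

  data Reach (S : Fin n → Set) (u : Fin n) : Fin n → Set where
    here : S u → Reach S u u
    step : ∀ {v w} → Reach S u v → Adj v w → S w → Reach S u w

  Connected : Set
  Connected = ∀ u v → Reach (λ _ → ⊤) u v

  -- face permutation φ = σ ∘ α
  φ : Dart n → Dart n
  φ d = proj₁ (α G d) , rot (proj₂ (α G d))

  φ^ : ℕ → Dart n → Dart n
  φ^ zero d = d
  φ^ (suc k) d = φ (φ^ k d)

  rank : Dart n → ℕ
  rank (v , i) = toℕ v * 3 + toℕ i

  allDarts : List (Dart n)
  allDarts = concatMap (λ v → map (λ i → (v , i)) (allFin 3)) (allFin n)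

  isFaceRep : Dart n → Bool
  isFaceRep d = all (λ k → rank d ≤ᵇ rank (φ^ k d)) (upTo (3 * n))

  faceCount : ℕ
  faceCount = sum (map (λ d → if isFaceRep d then 1 else 0) allDarts)

  -- plane: connected and of genus 0, i.e. Euler's formula V - E + F = 2
  -- with E = 3n/2, written without division as 2F = n + 4.
  IsPlane : Set
  IsPlane = Connected × (2 * faceCount ≡ n + 4)

  Hexagonal : Dart n → Set
  Hexagonal d = (φ^ 6 d ≡ d) × (∀ k → 1 ≤ k → k ≤ 5 → φ^ k d ≢ d)

  OnFace : Dart n → Fin n → Set
  OnFace d v = ∃ λ k → proj₁ (φ^ k d) ≡ v

  record Cycle (S : Fin n → Set) : Set where
    field
      m    : ℕ
      vtx  : Fin (3 + m) → Fin n
      inj  : ∀ i j → vtx i ≡ vtx j → i ≡ j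
      inS  : ∀ i → S (vtx i)
      adj  : ∀ (i : Fin (2 + m)) → Adj (vtx (inject₁ i)) (vtx (suc i))
      wrap : Adj (vtx (fromℕ (2 + m))) (vtx zero)

  InW InB : (Fin n → Bool) → Fin n → Set
  InW W v = W v ≡ true
  InB W v = W v ≡ false

  Stable : (Fin n → Bool) → Set
  Stable W = ∀ u v → InW W u → InW W v → ¬ Adj u v

  Forest : (Fin n → Set) → Set
  Forest S = ¬ Cycle S

  -- c labels the components of G[B]: exactly three components, labelled 0,1,2
  ComponentLabelling : (Fin n → Bool) → (Fin n → Fin 3) → Set
  ComponentLabelling W c =
    (∀ u v → InB W u → InB W v → (Reach (InB W) u v ⇔ (c u ≡ c v)))
    × (∀ j → ∃ λ v → InB W v × c v ≡ j)

  ImproperSTD : (Fin n → Bool) → Set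
  ImproperSTD W =
    Stable W × Forest (InB W) ×
    Σ (Fin n → Fin 3) λ c → ComponentLabelling W c ×
      ∃ λ d → Hexagonal d ×
        (∀ j → ∃ λ v → (InB W v × c v ≡ j × OnFace d v) ×
               (∀ w → InB W w → c w ≡ j → OnFace d w → w ≡ v))

size : {n : ℕ} → (Fin n → Bool) → ℕ
size {n} W = sum (map (λ v → if W v then 1 else 0) (allFin n))

-- Every vertex of the stable set W has all three neighbours in B, so counting darts gives
-- 3n = 6|W| + 2e(B), where e(B) is the number of edges of G[B].  A forest with three components
-- has e(B) = |B| - 3, and together with |W| + |B| = n this forces |B| = 3|W| - 6, i.e.
-- n + 2 = 4(|W| - 1).  The edge count of a tree T is squeezed from both sides: removing a leaf
-- (which a nonempty acyclic set has, since otherwise a non-backtracking walk closes a cycle)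
-- gives e(T) ≤ |T| - 1, and growing T from one vertex along boundary edges gives e(T) ≥ |T| - 1.
module Submission where

open import Defs
open import Data.Nat using (ℕ; zero; suc; _+_; _*_; _<_; _≤_; z≤n; z<s; s≤s⁻¹)
open import Data.Nat.Properties hiding (_≟_)
open import Data.Bool using (Bool; true; false; _∧_; _∨_; not; if_then_else_)
open import Data.Fin using (Fin; zero; suc; toℕ)
open import Data.Fin.Properties
  using (_≟_; any?; all?; ¬∀⟶∃¬; pigeonhole; toℕ-inject₁; toℕ-fromℕ; toℕ<n; toℕ-injective)
import Data.Fin.Properties as Finₚ
open import Data.Product using (∃; ∃₂; _×_; _,_; proj₁; proj₂; map₁; map₂)
open import Data.Product.Properties using (≡-dec)
open import Data.Sum using (_⊎_; inj₁; inj₂)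
open import Data.Empty using (⊥; ⊥-elim)
open import Data.List using (tabulate; _∷_; [])
open import Data.List.Properties using (map-tabulate)
import Data.Nat.ListAction as List
open import Function using (_∘_; id; const; _$_; _⇔_; mk⇔; Equivalence)
open import Relation.Nullary using (Dec; yes; no; ¬_; does)
open import Relation.Nullary.Decidable using (dec-true; dec-false; does-⇔; map′; _×-dec_)
open import Data.Bool.Properties using () renaming (_≟_ to _≟ᵇ_)
open import Relation.Binary.PropositionalEquality
open import Relation.Binary.Definitions using (DecidableEquality; tri<; tri≈; tri>)
open import Data.Nat.Tactic.RingSolver using (solve-∀; solve)
open import Algebra.Properties.CommutativeSemigroup +-commutativeSemigroup using (interchange)
open import Algebra.Properties.Semiring.Sum +-*-semiring
  using (sum; sum-syntax; sum-cong-≗; *-distribˡ-sum)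

⟦_⟧ : Bool → ℕ
⟦ b ⟧ = if b then 1 else 0

⟦does⟧-no : ∀ {p} {P : Set p} (P? : Dec P) → ¬ P → ⟦ does P? ⟧ ≡ 0
⟦does⟧-no P? ¬p = cong ⟦_⟧ (dec-false P? ¬p)

⟦does⟧-yes : ∀ {p} {P : Set p} (P? : Dec P) → P → ⟦ does P? ⟧ ≡ 1
⟦does⟧-yes P? p = cong ⟦_⟧ (dec-true P? p)

⟦does⟧-no-* : ∀ {p} {P : Set p} (P? : Dec P) → ¬ P → ∀ k → ⟦ does P? ⟧ * k ≡ 0
⟦does⟧-no-* P? ¬p k = cong (_* k) (⟦does⟧-no P? ¬p)

⟦does⟧-yes-* : ∀ {p} {P : Set p} (P? : Dec P) → P → ∀ k → ⟦ does P? ⟧ * k ≡ k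
⟦does⟧-yes-* P? p k = trans (cong (_* k) (⟦does⟧-yes P? p)) (*-identityˡ k)

⟦⟧-mono : ∀ {a b} → (a ≡ true → b ≡ true) → ⟦ a ⟧ ≤ ⟦ b ⟧
⟦⟧-mono {false} a⇒b = z≤n
⟦⟧-mono {true}  a⇒b rewrite a⇒b refl = ≤-refl

⟦⟧-complement : ∀ b → ⟦ b ⟧ + ⟦ not b ⟧ ≡ 1
⟦⟧-complement true  = refl
⟦⟧-complement false = refl

not≡true⇒≡false : ∀ {b} → not b ≡ true → b ≡ false
not≡true⇒≡false {false} _ = refl

≡false⇒not≡true : ∀ {b} → b ≡ false → not b ≡ true
≡false⇒not≡true refl = refl

sum-+ : ∀ {n} (f g : Fin n → ℕ) → ∑[ v < n ] (f v + g v) ≡ sum f + sum g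
sum-+ {zero}  f g = refl
sum-+ {suc n} f g = trans (cong (f zero + g zero +_) (sum-+ (f ∘ suc) (g ∘ suc)))
                          (interchange (f zero) (g zero) _ _)

sum-mono-≤ : ∀ {n} {f g : Fin n → ℕ} → (∀ v → f v ≤ g v) → sum f ≤ sum g
sum-mono-≤ {zero}  f≤g = z≤n
sum-mono-≤ {suc n} f≤g = +-mono-≤ (f≤g zero) (sum-mono-≤ (f≤g ∘ suc))

term≤sum : ∀ {n} (f : Fin n → ℕ) x → f x ≤ sum f
term≤sum f zero    = m≤m+n _ _
term≤sum f (suc x) = ≤-trans (term≤sum (f ∘ suc) x) (m≤n+m _ (f zero))

sum-const : ∀ n k → ∑[ v < n ] k ≡ n * k
sum-const zero    k = refl
sum-const (suc n) k = cong (k +_) (sum-const n k)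

sum-zero : ∀ {n} {f : Fin n → ℕ} → (∀ v → f v ≡ 0) → sum f ≡ 0
sum-zero {n} f≡0 = trans (sum-cong-≗ f≡0) (trans (sum-const n 0) (*-zeroʳ n))

sum≡0⇒zero : ∀ {n} (f : Fin n → ℕ) → sum f ≡ 0 → ∀ v → f v ≡ 0
sum≡0⇒zero f ∑f≡0 v = n≤0⇒n≡0 (subst (f v ≤_) ∑f≡0 (term≤sum f v))

sum-swap : ∀ {m n} (h : Fin m → Fin n → ℕ) →
           ∑[ u < m ] ∑[ v < n ] h u v ≡ ∑[ v < n ] ∑[ u < m ] h u v
sum-swap {zero} {n} h = sym (sum-zero {n} (λ _ → refl))
sum-swap {suc m} h = trans (cong (sum (h zero) +_) (sum-swap (h ∘ suc)))
                           (sym (sum-+ (h zero) (λ v → ∑[ u < m ] h (suc u) v)))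

sum-supported : ∀ {n} (f : Fin n → ℕ) x → (∀ v → v ≢ x → f v ≡ 0) → sum f ≡ f x
sum-supported f zero    f≡0 = trans (cong (f zero +_) (sum-zero (λ v → f≡0 (suc v) λ ()))) (+-identityʳ _)
sum-supported f (suc x) f≡0 =
  trans (cong (_+ sum (f ∘ suc)) (f≡0 zero λ ()))
        (sum-supported (f ∘ suc) x (λ v v≢x → f≡0 (suc v) (v≢x ∘ Finₚ.suc-injective)))

size≡sum : ∀ {n} (X : Fin n → Bool) → size X ≡ ∑[ v < n ] ⟦ X v ⟧
size≡sum X = trans (cong List.sum (map-tabulate id (⟦_⟧ ∘ X))) (sum-tabulate (⟦_⟧ ∘ X))
  where
  sum-tabulate : ∀ {m} (f : Fin m → ℕ) → List.sum (tabulate f) ≡ sum f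
  sum-tabulate {zero}  f = refl
  sum-tabulate {suc m} f = cong (f zero +_) (sum-tabulate (f ∘ suc))

module PairSums (m k : ℕ) where

  _≟²_ : DecidableEquality (Fin m × Fin k)
  _≟²_ = ≡-dec _≟_ _≟_

  ∑² : (Fin m × Fin k → ℕ) → ℕ
  ∑² f = ∑[ v < m ] ∑[ i < k ] f (v , i)

  ∑²-cong : ∀ {f g : Fin m × Fin k → ℕ} → (∀ d → f d ≡ g d) → ∑² f ≡ ∑² g
  ∑²-cong f≗g = sum-cong-≗ (λ v → sum-cong-≗ (λ i → f≗g (v , i)))

  ∑²-zero : ∀ {f : Fin m × Fin k → ℕ} → (∀ d → f d ≡ 0) → ∑² f ≡ 0
  ∑²-zero f≡0 = sum-zero {m} λ v → sum-zero {k} λ i → f≡0 (v , i)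

  ∑²-+ : ∀ (f g : Fin m × Fin k → ℕ) → ∑² (λ d → f d + g d) ≡ ∑² f + ∑² g
  ∑²-+ f g = trans (sum-cong-≗ (λ v → sum-+ (λ i → f (v , i)) (λ i → g (v , i))))
                   (sum-+ (λ v → ∑[ i < k ] f (v , i)) (λ v → ∑[ i < k ] g (v , i)))

  ∑²-mono-≤ : ∀ {f g : Fin m × Fin k → ℕ} → (∀ d → f d ≤ g d) → ∑² f ≤ ∑² g
  ∑²-mono-≤ f≤g = sum-mono-≤ (λ v → sum-mono-≤ (λ i → f≤g (v , i)))

  ∑²-swap : ∀ (h : Fin m × Fin k → Fin m × Fin k → ℕ) →
            ∑² (λ d → ∑² (λ e → h d e)) ≡ ∑² (λ e → ∑² (λ d → h d e))
  ∑²-swap h =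
    trans (sum-cong-≗ (λ v → sum-swap (λ i u → ∑[ j < k ] h (v , i) (u , j))))
    (trans (sum-swap (λ v u → ∑[ i < k ] ∑[ j < k ] h (v , i) (u , j)))
    (sum-cong-≗ (λ u → trans (sum-cong-≗ (λ v → sum-swap (λ i j → h (v , i) (u , j))))
                             (sum-swap (λ v j → ∑[ i < k ] h (v , i) (u , j))))))

  ∑²-point : ∀ x (g : Fin m × Fin k → ℕ) → ∑² (λ e → ⟦ does (e ≟² x) ⟧ * g e) ≡ g x
  ∑²-point x@(v , i) g =
    trans (sum-supported (λ u → ∑[ j < k ] (⟦ does ((u , j) ≟² x) ⟧ * g (u , j))) v
                         λ u u≢v → sum-zero {k} λ j → ⟦does⟧-no-* ((u , j) ≟² x) (u≢v ∘ cong proj₁) _)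
    (trans (sum-supported (λ j → ⟦ does ((v , j) ≟² x) ⟧ * g (v , j)) i
                          λ j j≢i → ⟦does⟧-no-* ((v , j) ≟² x) (j≢i ∘ cong proj₂) _)
           (⟦does⟧-yes-* (x ≟² x) refl (g x)))

  ∑²-row : ∀ c (f : Fin m × Fin k → ℕ) → ∑² (λ d → ⟦ does (proj₁ d ≟ c) ⟧ * f d) ≡ ∑[ i < k ] f (c , i)
  ∑²-row c f =
    trans (sum-supported (λ u → ∑[ i < k ] (⟦ does (u ≟ c) ⟧ * f (u , i))) c
                         λ u u≢c → sum-zero {k} λ i → ⟦does⟧-no-* (u ≟ c) u≢c _)
          (sum-cong-≗ {k} λ i → ⟦does⟧-yes-* (c ≟ c) refl _)

  ∑²-proj₁ : ∀ (f : Fin m → ℕ) → ∑² (λ d → f (proj₁ d)) ≡ k * sum f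
  ∑²-proj₁ f = trans (sum-cong-≗ {m} λ v → sum-const k (f v)) (sym (*-distribˡ-sum k f))

  ∑²-sum-swap : ∀ {l} (h : Fin m × Fin k → Fin l → ℕ) →
                ∑² (λ d → ∑[ j < l ] h d j) ≡ ∑[ j < l ] ∑² (λ d → h d j)
  ∑²-sum-swap h = trans (sum-cong-≗ (λ v → sum-swap (λ i j → h (v , i) j)))
                        (sum-swap (λ v j → ∑[ i < k ] h (v , i) j))

  ∑²-invol : ∀ (σ : Fin m × Fin k → Fin m × Fin k) → (∀ d → σ (σ d) ≡ d) →
             ∀ (f : Fin m × Fin k → ℕ) → ∑² (f ∘ σ) ≡ ∑² f
  ∑²-invol σ σσ f = begin
    ∑² (f ∘ σ)
      ≡⟨ ∑²-cong (λ d → ∑²-point (σ d) f) ⟨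
    ∑² (λ d → ∑² (λ e → ⟦ does (e ≟² σ d) ⟧ * f e))
      ≡⟨ ∑²-swap _ ⟩
    ∑² (λ e → ∑² (λ d → ⟦ does (e ≟² σ d) ⟧ * f e))
      ≡⟨ ∑²-cong (λ e → ∑²-cong λ d → cong (λ b → ⟦ b ⟧ * f e) (mirror e d)) ⟩
    ∑² (λ e → ∑² (λ d → ⟦ does (d ≟² σ e) ⟧ * f e))
      ≡⟨ ∑²-cong (λ e → ∑²-point (σ e) (λ _ → f e)) ⟩
    ∑² f ∎
    where
    open ≡-Reasoning
    mirror : ∀ e d → does (e ≟² σ d) ≡ does (d ≟² σ e)
    mirror e d = does-⇔ (mk⇔ (λ { refl → sym (σσ d) }) (λ { refl → sym (σσ e) })) (e ≟² σ d) (d ≟² σ e)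

least-witness : ∀ {p} {P : ℕ → Set p} → (∀ k → Dec (P k)) →
                ∀ {m} → P m → ∃ λ j → P j × (∀ {k} → k < j → ¬ P k)
least-witness {P = P} P? {m} Pm = go (suc m) m ≤-refl Pm
  where
  go : ∀ b m → m < b → P m → ∃ λ j → P j × (∀ {k} → k < j → ¬ P k)
  go (suc b) m m<b Pm with anyUpTo? P? m
  ... | yes (k , k<m , Pk) = go b k (<-≤-trans k<m (s≤s⁻¹ m<b)) Pk
  ... | no ∄k            = m , Pm , λ k<m Pk → ∄k (_ , k<m , Pk)

leaf-step : ∀ {a d s} → d ≤ 1 → a + 2 ≤ 2 * s → a + 2 * d + 2 ≤ 2 * (s + 1)
leaf-step {a} {d} {s} d≤1 a+2≤2s = begin
  a + 2 * d + 2  ≤⟨ +-monoˡ-≤ 2 (+-monoʳ-≤ a (*-monoʳ-≤ 2 d≤1)) ⟩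
  a + 2 + 2      ≤⟨ +-monoˡ-≤ 2 a+2≤2s ⟩
  2 * s + 2      ≡⟨ *-distribˡ-+ 2 s 1 ⟨
  2 * (s + 1)    ∎
  where open ≤-Reasoning

growth-step : ∀ {a o s} → 1 ≤ o → 2 * s ≤ a + 2 → 2 * (s + 1) ≤ a + 2 * o + 2
growth-step {a} {o} {s} 1≤o 2s≤a+2 = begin
  2 * (s + 1)    ≡⟨ *-distribˡ-+ 2 s 1 ⟩
  2 * s + 2      ≤⟨ +-monoˡ-≤ 2 2s≤a+2 ⟩
  a + 2 + 2      ≤⟨ +-monoˡ-≤ 2 (+-monoʳ-≤ a (*-monoʳ-≤ 2 1≤o)) ⟩
  a + 2 * o + 2  ∎
  where open ≤-Reasoning

vertex-count : ∀ {n w b e} → 3 * n ≡ 3 * w + 3 * w + e → e + 2 * 3 ≡ 2 * b → w + b ≡ n →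
               ∃ λ k → (n + 2 ≡ 4 * k) × (w ≡ k + 1)
vertex-count {n} {w} {b} {e} dart-count forest partition = shift w b+6≡3w partition
  where
  open ≡-Reasoning
  b+6≡3w : b + 6 ≡ 3 * w
  b+6≡3w = sym (+-cancelˡ-≡ (3 * w + 2 * b) (3 * w) (b + 6) (begin
    3 * w + 2 * b + 3 * w        ≡⟨ cong (λ x → 3 * w + x + 3 * w) forest ⟨
    3 * w + (e + 6) + 3 * w      ≡⟨ solve (w ∷ e ∷ []) ⟩
    3 * w + 3 * w + e + 6        ≡⟨ cong (_+ 6) dart-count ⟨
    3 * n + 6                    ≡⟨ cong (λ x → 3 * x + 6) partition ⟨
    3 * (w + b) + 6              ≡⟨ solve (w ∷ b ∷ []) ⟩
    3 * w + 2 * b + (b + 6)      ∎))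
  shift : ∀ w → b + 6 ≡ 3 * w → w + b ≡ n → ∃ λ k → (n + 2 ≡ 4 * k) × (w ≡ k + 1)
  shift zero    b+6≡0  _         with () ← trans (+-comm 6 b) b+6≡0
  shift (suc k) b+6≡3w partition = k , +-cancelʳ-≡ 4 (n + 2) (4 * k) (begin
    n + 2 + 4                    ≡⟨ +-assoc n 2 4 ⟩
    n + 6                        ≡⟨ cong (_+ 6) partition ⟨
    suc k + b + 6                ≡⟨ +-assoc (suc k) b 6 ⟩
    suc k + (b + 6)              ≡⟨ cong (suc k +_) b+6≡3w ⟩
    suc k + 3 * suc k            ≡⟨ solve (k ∷ []) ⟩
    4 * k + 4                    ∎) , +-comm 1 k

VSet : ℕ → Set
VSet n = Fin n → Bool

module _ {n : ℕ} where

  ∅ : VSet n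
  ∅ _ = false

  card : VSet n → ℕ
  card X = ∑[ v < n ] ⟦ X v ⟧

  _⊆_ : VSet n → VSet n → Set
  X ⊆ Y = ∀ v → X v ≡ true → Y v ≡ true

  remove : Fin n → VSet n → VSet n
  remove c X v = X v ∧ not (does (v ≟ c))

  insert : Fin n → VSet n → VSet n
  insert c Y v = Y v ∨ does (v ≟ c)

  ⊆-insert : ∀ c Y → Y ⊆ insert c Y
  ⊆-insert c Y v Yv rewrite Yv = refl

  insert-⊆ : ∀ {c Y X} → Y ⊆ X → X c ≡ true → insert c Y ⊆ X
  insert-⊆ {c} {Y} Y⊆X Xc v with Y v in Yv | v ≟ c
  ... | true  | _        = const (Y⊆X v Yv)
  ... | false | yes refl = const Xc
  ... | false | no _     = λ ()

  remove-⊆ : ∀ c X → remove c X ⊆ X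
  remove-⊆ c X v with X v
  ... | true  = const refl
  ... | false = id

  -- X is Y with the new vertex c added, stated on indicators so that sums split additively
  IsInsert : Fin n → VSet n → VSet n → Set
  IsInsert c Y X = ∀ v → ⟦ X v ⟧ ≡ ⟦ Y v ⟧ + ⟦ does (v ≟ c) ⟧

  insert-remove : ∀ {c X} → X c ≡ true → IsInsert c (remove c X) X
  insert-remove {c} {X} Xc v with v ≟ c
  ... | yes refl rewrite Xc = refl
  ... | no _     with X v
  ...   | true  = refl
  ...   | false = refl

  insert-fresh : ∀ {c Y} → Y c ≡ false → IsInsert c Y (insert c Y)
  insert-fresh {c} {Y} Yc v with v ≟ c
  ... | yes refl rewrite Yc = refl
  ... | no _     with Y v
  ...   | true  = refl
  ...   | false = refl

  card-insert : ∀ {c X Y} → IsInsert c Y X → card X ≡ card Y + 1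
  card-insert {c} {X} {Y} ins =
    trans (sum-cong-≗ ins)
    (trans (sum-+ (⟦_⟧ ∘ Y) (λ v → ⟦ does (v ≟ c) ⟧))
           (cong (card Y +_) (trans (sum-supported (λ v → ⟦ does (v ≟ c) ⟧) c (λ v → ⟦does⟧-no (v ≟ c)))
                                    (⟦does⟧-yes (c ≟ c) refl))))

card-mono : ∀ {n} {X Y : VSet n} → X ⊆ Y → card X ≤ card Y
card-mono X⊆Y = sum-mono-≤ λ v → ⟦⟧-mono (X⊆Y v)

card-<-witness : ∀ {n} {X Y : VSet n} → X ⊆ Y → card X < card Y → ∃ λ t → Y t ≡ true × X t ≡ false
card-<-witness {n} {X} {Y} X⊆Y ∣X∣<∣Y∣ with any? (λ t → (Y t ≟ᵇ true) ×-dec (X t ≟ᵇ false))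
... | yes witness = witness
... | no ∄witness = ⊥-elim (<⇒≱ ∣X∣<∣Y∣ (card-mono Y⊆X))
  where
  Y⊆X : Y ⊆ X
  Y⊆X v Yv with X v in Xv
  ... | true  = refl
  ... | false = ⊥-elim (∄witness (v , Yv , Xv))

card-nonempty : ∀ {n m} (X : VSet n) → card X ≡ suc m → ∃ λ v → X v ≡ true
card-nonempty {n} X ∣X∣≡1+m =
  map₂ proj₁ (card-<-witness (λ _ ()) (subst₂ _<_ (sym (sum-zero {n} λ _ → refl)) (sym ∣X∣≡1+m) z<s))

card-complement : ∀ {n} (W : VSet n) → card W + card (not ∘ W) ≡ n
card-complement {n} W = begin
  card W + card (not ∘ W)           ≡⟨ sum-+ (⟦_⟧ ∘ W) (⟦_⟧ ∘ not ∘ W) ⟨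
  ∑[ v < n ] (⟦ W v ⟧ + ⟦ not (W v) ⟧)  ≡⟨ sum-cong-≗ (⟦⟧-complement ∘ W) ⟩
  ∑[ v < n ] 1                      ≡⟨ sum-const n 1 ⟩
  n * 1                             ≡⟨ *-identityʳ n ⟩
  n                                 ∎
  where open ≡-Reasoning

module _ {n k : ℕ} where

  part : (Fin n → Fin k) → VSet n → Fin k → VSet n
  part ℓ B j v = B v ∧ does (ℓ v ≟ j)

  ⟦⟧-part : ∀ ℓ B v → ⟦ B v ⟧ ≡ ∑[ j < k ] ⟦ part ℓ B j v ⟧
  ⟦⟧-part ℓ B v with B v
  ... | false = sym (sum-zero {k} λ _ → refl)
  ... | true  = sym (trans (sum-supported (λ j → ⟦ does (ℓ v ≟ j) ⟧) (ℓ v) (λ j j≢ℓv → ⟦does⟧-no (ℓ v ≟ j) (j≢ℓv ∘ sym)))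
                           (⟦does⟧-yes (ℓ v ≟ ℓ v) refl))

  ⟦⟧-part² : ∀ ℓ B s t → (B s ≡ true → B t ≡ true → ℓ s ≡ ℓ t) →
             ⟦ B s ⟧ * ⟦ B t ⟧ ≡ ∑[ j < k ] (⟦ part ℓ B j s ⟧ * ⟦ part ℓ B j t ⟧)
  ⟦⟧-part² ℓ B s t same with B s | B t | same
  ... | false | _     | _    = sym (sum-zero {k} λ _ → refl)
  ... | true  | false | _    = sym (sum-zero {k} λ j → *-zeroʳ ⟦ does (ℓ s ≟ j) ⟧)
  ... | true  | true  | same′ rewrite same′ refl refl = sym (trans
        (sum-supported (λ j → ⟦ does (ℓ t ≟ j) ⟧ * ⟦ does (ℓ t ≟ j) ⟧) (ℓ t)
                       (λ j j≢ℓt → ⟦does⟧-no-* (ℓ t ≟ j) (j≢ℓt ∘ sym) _))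
        (trans (⟦does⟧-yes-* (ℓ t ≟ ℓ t) refl _) (⟦does⟧-yes (ℓ t ≟ ℓ t) refl)))

  part-⊆ : ∀ ℓ B j → part ℓ B j ⊆ B
  part-⊆ ℓ B j v with B v
  ... | true  = const refl
  ... | false = id

  part-member : ∀ ℓ B {j v} → part ℓ B j v ≡ true → ℓ v ≡ j
  part-member ℓ B {j} {v} ∈part with B v | ℓ v ≟ j
  ... | true | yes ℓv≡j = ℓv≡j

  member-part : ∀ ℓ B {j v} → B v ≡ true → ℓ v ≡ j → part ℓ B j v ≡ true
  member-part ℓ B {j} {v} Bv ℓv≡j rewrite Bv = dec-true (ℓ v ≟ j) ℓv≡j

  card-part : ∀ ℓ B → card B ≡ ∑[ j < k ] card (part ℓ B j)
  card-part ℓ B = trans (sum-cong-≗ (⟦⟧-part ℓ B)) (sum-swap (λ v j → ⟦ part ℓ B j v ⟧))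

module _ {n : ℕ} (G : CubicMap n) where

  open PairSums n 3

  tgt : Dart n → Fin n
  tgt d = proj₁ (α G d)

  -- each edge of G[X] is counted twice, once from each end
  darts : VSet n → ℕ
  darts X = ∑² (λ d → ⟦ X (proj₁ d) ⟧ * ⟦ X (tgt d) ⟧)

  degIn : VSet n → Fin n → ℕ
  degIn X c = ∑[ i < 3 ] ⟦ X (tgt (c , i)) ⟧

  darts-mono : ∀ {X Y} → X ⊆ Y → darts X ≤ darts Y
  darts-mono X⊆Y = ∑²-mono-≤ λ d → *-mono-≤ (⟦⟧-mono (X⊆Y (proj₁ d))) (⟦⟧-mono (X⊆Y (tgt d)))

  darts-empty : ∀ X → card X ≡ 0 → darts X ≡ 0
  darts-empty X ∣X∣≡0 = ∑²-zero λ d → cong (_* ⟦ X (tgt d) ⟧) (sum≡0⇒zero (⟦_⟧ ∘ X) ∣X∣≡0 (proj₁ d))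

  degIn-empty : ∀ X c → card X ≡ 0 → degIn X c ≡ 0
  degIn-empty X c ∣X∣≡0 = sum-zero {3} λ i → sum≡0⇒zero (⟦_⟧ ∘ X) ∣X∣≡0 (tgt (c , i))

  darts-insert : ∀ {c X Y} → IsInsert c Y X → darts X ≡ darts Y + 2 * degIn Y c
  darts-insert {c} {X} {Y} ins = begin
    darts X
      ≡⟨ ∑²-cong (λ d → cong₂ _*_ (ins (proj₁ d)) (ins (tgt d))) ⟩
    ∑² (λ d → (y (proj₁ d) + δ (proj₁ d)) * (y (tgt d) + δ (tgt d)))
      ≡⟨ ∑²-cong (λ d → expand (y (proj₁ d)) (δ (proj₁ d)) (y (tgt d)) (δ (tgt d))) ⟩
    ∑² (λ d → y (proj₁ d) * y (tgt d) + (leave d + enter d + loop d))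
      ≡⟨ ∑²-+ (λ d → y (proj₁ d) * y (tgt d)) (λ d → leave d + enter d + loop d) ⟩
    darts Y + ∑² (λ d → leave d + enter d + loop d)
      ≡⟨ cong (darts Y +_) (∑²-+ (λ d → leave d + enter d) loop) ⟩
    darts Y + (∑² (λ d → leave d + enter d) + ∑² loop)
      ≡⟨ cong (darts Y +_) (cong₂ _+_ (∑²-+ leave enter) (∑²-zero no-loop)) ⟩
    darts Y + (∑² leave + ∑² enter + 0)
      ≡⟨ cong (λ e → darts Y + (∑² leave + e + 0))
              (trans (∑²-cong enter≡leave∘α) (∑²-invol (α G) (α-invol G) leave)) ⟩
    darts Y + (∑² leave + ∑² leave + 0)
      ≡⟨ cong (darts Y +_) (double (∑² leave)) ⟩
    darts Y + 2 * ∑² leave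
      ≡⟨ cong (λ e → darts Y + 2 * e) (∑²-row c (y ∘ tgt)) ⟩
    darts Y + 2 * degIn Y c ∎
    where
    open ≡-Reasoning
    y δ : Fin n → ℕ
    y v = ⟦ Y v ⟧
    δ v = ⟦ does (v ≟ c) ⟧
    leave enter loop : Dart n → ℕ
    leave d = δ (proj₁ d) * y (tgt d)
    enter d = y (proj₁ d) * δ (tgt d)
    loop d  = δ (proj₁ d) * δ (tgt d)
    expand : ∀ a b c d → (a + b) * (c + d) ≡ a * c + (b * c + a * d + b * d)
    expand = solve-∀
    double : ∀ a → a + a + 0 ≡ 2 * a
    double = solve-∀
    enter≡leave∘α : ∀ d → enter d ≡ leave (α G d)
    enter≡leave∘α d rewrite α-invol G d = *-comm (y (proj₁ d)) (δ (tgt d))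
    no-loop : ∀ d → loop d ≡ 0
    no-loop d@(v , i) with v ≟ c
    ... | no _     = refl
    ... | yes refl = trans (*-identityˡ (δ (tgt d))) (⟦does⟧-no (tgt d ≟ v) (noLoop G v i))

  record NonBacktrackingWalk (S : Fin n → Set) : Set where
    field
      x     : ℕ → Fin n
      x∈S   : ∀ k → S (x k)
      adj   : ∀ k → Adj G (x k) (x (suc k))
      ¬back : ∀ k → x (suc (suc k)) ≢ x k

  module _ {S : Fin n → Set} (w : NonBacktrackingWalk S) where
    open NonBacktrackingWalk w

    Repeats : ℕ → Set
    Repeats j = ∃ λ i → i < j × x i ≡ x j

    repeats : ∃ Repeats
    repeats with a , b , a<b , xa≡xb ← pigeonhole (n<1+n n) (x ∘ toℕ) = toℕ b , toℕ a , a<b , xa≡xb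

    ¬loop : ∀ k → x (suc k) ≢ x k
    ¬loop k x₁≡x₀ with s , eq ← adj k = noLoop G (x k) s (trans eq x₁≡x₀)

    cycle-before-first-repeat : ∀ {i} m → x i ≡ x (i + (3 + m)) → (∀ {k} → k < i + (3 + m) → ¬ Repeats k) →
                                Cycle G S
    cycle-before-first-repeat {i} m xi≡xj first = record
      { m    = m
      ; vtx  = vtx
      ; inj  = inj
      ; inS  = λ l → x∈S (i + toℕ l)
      ; adj  = λ l → subst₂ (λ a b → Adj G (x a) (x b))
                            (cong (i +_) (sym (toℕ-inject₁ l))) (sym (+-suc i (toℕ l))) (adj (i + toℕ l))
      ; wrap = subst₂ (λ a b → Adj G (x a) b)
                      (cong (i +_) (sym (toℕ-fromℕ (2 + m))))
                      (trans (cong x (sym (+-suc i (2 + m)))) (trans (sym xi≡xj) (cong x (sym (+-identityʳ i)))))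
                      (adj (i + (2 + m)))
      }
      where
      vtx : Fin (3 + m) → Fin n
      vtx l = x (i + toℕ l)
      inj : ∀ l l' → vtx l ≡ vtx l' → l ≡ l'
      inj l l' eq with <-cmp (toℕ l) (toℕ l')
      ... | tri< l<l' _ _ = ⊥-elim (first (+-monoʳ-< i (toℕ<n l')) (i + toℕ l , +-monoʳ-< i l<l' , eq))
      ... | tri≈ _ l≡l' _ = toℕ-injective l≡l'
      ... | tri> _ _ l>l' = ⊥-elim (first (+-monoʳ-< i (toℕ<n l)) (i + toℕ l' , +-monoʳ-< i l>l' , sym eq))

    NonBacktrackingWalk⇒Cycle : Cycle G S
    NonBacktrackingWalk⇒Cycle
      with j , (i , i<j , xi≡xj) , first ← least-witness (λ j → anyUpTo? (λ i → x i ≟ x j) j) (proj₂ repeats)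
      with m≤n⇒∃[o]m+o≡n (<⇒≤ i<j)
    ... | zero , refl = ⊥-elim (<-irrefl (sym (+-identityʳ i)) i<j)
    ... | suc zero , refl = ⊥-elim (¬loop i (trans (cong x (+-comm 1 i)) (sym xi≡xj)))
    ... | suc (suc zero) , refl = ⊥-elim (¬back i (trans (cong x (+-comm 2 i)) (sym xi≡xj)))
    ... | suc (suc (suc m)) , refl = cycle-before-first-repeat m xi≡xj first

  Forest-mono : ∀ {S S′ : Fin n → Set} → (∀ v → S′ v → S v) → Forest G S → Forest G S′
  Forest-mono S′⊆S acyclic cyc = acyclic (record { Cycle cyc ; inS = λ l → S′⊆S _ (Cycle.inS cyc l) })

  Reach-mono : ∀ {S S′ : Fin n → Set} {u v} → (∀ v → S v → S′ v) → Reach G S u v → Reach G S′ u v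
  Reach-mono S⊆S′ (here Su)         = here (S⊆S′ _ Su)
  Reach-mono S⊆S′ (step path vw Sw) = step (Reach-mono S⊆S′ path) vw (S⊆S′ _ Sw)

  Leaf : VSet n → Fin n → Fin n → Set
  Leaf X c p = ∀ i → X (tgt (c , i)) ≡ true → tgt (c , i) ≡ p

  Branching : VSet n → Set
  Branching X = ∀ c → X c ≡ true → ∀ p → ∃ λ i → X (tgt (c , i)) ≡ true × tgt (c , i) ≢ p

  leaf-slot? : ∀ (X : VSet n) c p (i : Fin 3) → Dec (X (tgt (c , i)) ≡ true → tgt (c , i) ≡ p)
  leaf-slot? X c p i with X (tgt (c , i))
  ... | false = yes λ ()
  ... | true  = map′ const (_$ refl) (tgt (c , i) ≟ p)

  leaf-or-branching : ∀ X → (∃₂ λ c p → X c ≡ true × Leaf X c p) ⊎ Branching X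
  leaf-or-branching X with any? (λ c → (X c ≟ᵇ true) ×-dec any? (λ p → all? (leaf-slot? X c p)))
  ... | yes (c , Xc , p , leaf) = inj₁ (c , p , Xc , leaf)
  ... | no ∄leaf = inj₂ λ c Xc p → branch c p (¬∀⟶∃¬ 3 _ (leaf-slot? X c p) λ leaf → ∄leaf (c , Xc , p , leaf))
    where
    branch : ∀ c p → (∃ λ i → ¬ (X (tgt (c , i)) ≡ true → tgt (c , i) ≡ p)) →
             ∃ λ i → X (tgt (c , i)) ≡ true × tgt (c , i) ≢ p
    branch c p (i , ¬leaf) with X (tgt (c , i)) in Xt
    ... | true  = i , Xt , λ t≡p → ¬leaf (const t≡p)
    ... | false = ⊥-elim (¬leaf λ ())

  branching-walk : ∀ {X c₀} → X c₀ ≡ true → Branching X → NonBacktrackingWalk (λ v → X v ≡ true)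
  branching-walk {X} {c₀} Xc₀ branching = record
    { x     = current
    ; x∈S   = proj₂ ∘ proj₂ ∘ state
    ; adj   = λ k → proj₁ (choice k) , refl
    ; ¬back = λ k → proj₂ (proj₂ (choice (suc k)))
    }
    where
    -- the previous and the current vertex of the walk
    state : ℕ → Fin n × ∃ λ c → X c ≡ true
    choice : ∀ k → let (p , c , _) = state k in ∃ λ i → X (tgt (c , i)) ≡ true × tgt (c , i) ≢ p
    state zero    = c₀ , c₀ , Xc₀
    state (suc k) = let (_ , c , _) = state k ; (i , Xt , _) = choice k in c , tgt (c , i) , Xt
    choice k with p , c , Xc ← state k = branching c Xc p
    current : ℕ → Fin n
    current = proj₁ ∘ proj₂ ∘ state

  degIn-mono : ∀ {X Y} c → Y ⊆ X → degIn Y c ≤ degIn X c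
  degIn-mono c Y⊆X = sum-mono-≤ λ i → ⟦⟧-mono (Y⊆X (tgt (c , i)))

  leaf-single-slot : ∀ {X c p} → Leaf X c p → ∀ i j → i ≢ j →
                     X (tgt (c , i)) ≡ true → X (tgt (c , j)) ≡ true → ⊥
  leaf-single-slot {c = c} leaf i j i≢j Xi Xj = noMulti G c i j i≢j (trans (leaf i Xi) (sym (leaf j Xj)))

  degIn-leaf : ∀ {X c p} → Leaf X c p → degIn X c ≤ 1
  degIn-leaf {X} {c} {p} leaf
    with X (tgt (c , zero)) in X₀ | X (tgt (c , suc zero)) in X₁ | X (tgt (c , suc (suc zero))) in X₂
  ... | false | false | false = z≤n
  ... | false | false | true  = ≤-refl
  ... | false | true  | false = ≤-refl
  ... | true  | false | false = ≤-refl
  ... | true  | true  | _     = ⊥-elim (leaf-single-slot {X} {c} {p} leaf zero (suc zero) (λ ()) X₀ X₁)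
  ... | true  | false | true  = ⊥-elim (leaf-single-slot {X} {c} {p} leaf zero (suc (suc zero)) (λ ()) X₀ X₂)
  ... | false | true  | true  = ⊥-elim (leaf-single-slot {X} {c} {p} leaf (suc zero) (suc (suc zero)) (λ ()) X₁ X₂)

  forest-has-leaf : ∀ {m} X → Forest G (λ v → X v ≡ true) → card X ≡ suc m →
                    ∃ λ c → X c ≡ true × degIn (remove c X) c ≤ 1
  forest-has-leaf X acyclic ∣X∣≡1+m with c₀ , Xc₀ ← card-nonempty X ∣X∣≡1+m with leaf-or-branching X
  ... | inj₂ branching = ⊥-elim (acyclic (NonBacktrackingWalk⇒Cycle (branching-walk Xc₀ branching)))
  ... | inj₁ (c , p , Xc , leaf) = c , Xc , ≤-trans (degIn-mono c (remove-⊆ c X)) (degIn-leaf {X} {c} {p} leaf)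

  forest-bound : ∀ m X → Forest G (λ v → X v ≡ true) → card X ≡ suc m → darts X + 2 ≤ 2 * card X
  forest-bound m X acyclic ∣X∣≡1+m with c , Xc , deg≤1 ← forest-has-leaf X acyclic ∣X∣≡1+m = begin
    darts X + 2                    ≡⟨ cong (_+ 2) (darts-insert ins) ⟩
    darts X' + 2 * degIn X' c + 2  ≤⟨ bound m ∣X'∣≡m ⟩
    2 * (card X' + 1)              ≡⟨ cong (2 *_) (card-insert ins) ⟨
    2 * card X                     ∎
    where
    open ≤-Reasoning
    X' = remove c X
    ins : IsInsert c X' X
    ins = insert-remove Xc
    ∣X'∣≡m : card X' ≡ m
    ∣X'∣≡m = +-cancelʳ-≡ 1 _ _ (trans (sym (card-insert ins)) (trans ∣X∣≡1+m (+-comm 1 m)))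
    bound : ∀ k → card X' ≡ k → darts X' + 2 * degIn X' c + 2 ≤ 2 * (card X' + 1)
    bound zero    ∣X'∣≡0 rewrite darts-empty X' ∣X'∣≡0 | degIn-empty X' c ∣X'∣≡0 | ∣X'∣≡0 = ≤-refl
    bound (suc k) ∣X'∣≡1+k =
      leaf-step {s = card X'} deg≤1 (forest-bound k X' (Forest-mono (remove-⊆ c X) acyclic) ∣X'∣≡1+k)

  Adj⇒slot : ∀ {v w} → Adj G v w → ∃ λ j → tgt (w , j) ≡ v
  Adj⇒slot {v} (i , refl) = proj₂ (α G (v , i)) , cong proj₁ (α-invol G (v , i))

  degIn-pos : ∀ {X v w} → X v ≡ true → Adj G v w → 1 ≤ degIn X w
  degIn-pos {X} {v} {w} Xv vw with j , wj≡v ← Adj⇒slot vw =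
    ≤-trans (≤-reflexive (cong ⟦_⟧ (sym (trans (cong X wj≡v) Xv)))) (term≤sum (λ i → ⟦ X (tgt (w , i)) ⟧) j)

  boundary-edge : ∀ {P a t} → Reach G P a t → ∀ (U : VSet n) → U a ≡ true → U t ≡ false →
                  ∃₂ λ v w → U v ≡ true × U w ≡ false × P w × Adj G v w
  boundary-edge (here _) U Ua Ut with () ← trans (sym Ua) Ut
  boundary-edge (step {v} {w} path vw Pw) U Ua Uw with U v in Uv
  ... | true  = v , w , Uv , Uw , Pw , vw
  ... | false = boundary-edge path U Ua Uv

  module _ (P : Fin n → Set) (X : VSet n)
           (connected : ∀ u v → X u ≡ true → X v ≡ true → Reach G P u v)
           (closed : ∀ v w → X v ≡ true → P w → Adj G v w → X w ≡ true) where

    component-growth : ∀ m {a U} → U a ≡ true → U ⊆ X → 2 * card U ≤ darts U + 2 → card U + m ≡ card X →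
                       2 * card X ≤ darts X + 2
    component-growth zero {U = U} _ U⊆X bound ∣U∣≡∣X∣ = begin
      2 * card X     ≡⟨ cong (2 *_) (trans (sym ∣U∣≡∣X∣) (+-identityʳ (card U))) ⟩
      2 * card U     ≤⟨ bound ⟩
      darts U + 2    ≤⟨ +-monoˡ-≤ 2 (darts-mono U⊆X) ⟩
      darts X + 2    ∎
      where open ≤-Reasoning
    component-growth (suc m) {a} {U} Ua U⊆X bound ∣U∣+1+m≡∣X∣
      with t , Xt , Ut ← card-<-witness U⊆X (subst (card U <_) ∣U∣+1+m≡∣X∣ (m<m+n (card U) z<s))
      with v , w , Uv , Uw , Pw , vw ← boundary-edge (connected a t (U⊆X a Ua)  Xt) U Ua Ut =
      component-growth m (⊆-insert w U a Ua) (insert-⊆ U⊆X Xw) bound′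
        (trans (cong (_+ m) (card-insert ins)) (trans (+-assoc (card U) 1 m) ∣U∣+1+m≡∣X∣))
      where
      Xw : X w ≡ true
      Xw = closed v w (U⊆X v Uv) Pw vw
      ins : IsInsert w U (insert w U)
      ins = insert-fresh Uw
      bound′ : 2 * card (insert w U) ≤ darts (insert w U) + 2
      bound′ rewrite card-insert ins | darts-insert ins = growth-step {s = card U} (degIn-pos {U} Uv vw) bound

    component-bound : ∀ {a} → X a ≡ true → 2 * card X ≤ darts X + 2
    component-bound {a} Xa =
      component-growth (proj₁ gap) {a} (dec-true (a ≟ a) refl) U⊆X
        (subst (λ k → 2 * k ≤ darts U + 2) (sym ∣U∣≡1) (m≤n+m 2 (darts U))) (proj₂ gap)
      where
      U : VSet n
      U = insert a ∅
      U⊆X : U ⊆ X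
      U⊆X = insert-⊆ (λ _ ()) Xa
      ∣U∣≡1 : card U ≡ 1
      ∣U∣≡1 = trans (card-insert (insert-fresh {c = a} {Y = ∅} refl)) (cong (_+ 1) (sum-zero {n} λ _ → refl))
      gap : ∃ λ m → card U + m ≡ card X
      gap = m≤n⇒∃[o]m+o≡n (card-mono U⊆X)

    tree-edges : Forest G (λ v → X v ≡ true) → ∀ {a} → X a ≡ true → darts X + 2 ≡ 2 * card X
    tree-edges acyclic {a} Xa = ≤-antisym (forest-bound (proj₁ gap) X acyclic (proj₂ gap)) (component-bound Xa)
      where
      gap : ∃ λ m → card X ≡ suc m
      gap = map₂ sym (m≤n⇒∃[o]m+o≡n (subst (_≤ card X) (cong ⟦_⟧ Xa) (term≤sum (⟦_⟧ ∘ X) a)))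

  darts-part : ∀ {k} (ℓ : Fin n → Fin k) B → (∀ {v w} → B v ≡ true → B w ≡ true → Adj G v w → ℓ v ≡ ℓ w) →
               darts B ≡ ∑[ j < k ] darts (part ℓ B j)
  darts-part ℓ B same = trans
    (∑²-cong λ d@(v , i) → ⟦⟧-part² ℓ B v (tgt d) λ Bv Bt → same Bv Bt (i , refl))
    (∑²-sum-swap (λ d j → ⟦ part ℓ B j (proj₁ d) ⟧ * ⟦ part ℓ B j (tgt d) ⟧))

  forest-edges : ∀ {k} (B : VSet n) (ℓ : Fin n → Fin k) → Forest G (λ v → B v ≡ true) →
                 (∀ u v → B u ≡ true → B v ≡ true → Reach G (λ v → B v ≡ true) u v ⇔ ℓ u ≡ ℓ v) →
                 (∀ j → ∃ λ v → B v ≡ true × ℓ v ≡ j) →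
                 darts B + 2 * k ≡ 2 * card B
  forest-edges {k} B ℓ acyclic components nonempty = begin
    darts B + 2 * k                        ≡⟨ cong₂ _+_ (darts-part ℓ B adjacent-same) 2k≡∑2 ⟩
    ∑[ j < k ] darts (T j) + ∑[ j < k ] 2  ≡⟨ sum-+ (darts ∘ T) (const 2) ⟨
    ∑[ j < k ] (darts (T j) + 2)           ≡⟨ sum-cong-≗ tree ⟩
    ∑[ j < k ] (2 * card (T j))            ≡⟨ *-distribˡ-sum 2 (card ∘ T) ⟨
    2 * ∑[ j < k ] card (T j)              ≡⟨ cong (2 *_) (card-part ℓ B) ⟨
    2 * card B                             ∎
    where
    open ≡-Reasoning
    T : Fin k → VSet n
    T = part ℓ B
    2k≡∑2 : 2 * k ≡ ∑[ j < k ] 2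
    2k≡∑2 = trans (*-comm 2 k) (sym (sum-const k 2))
    adjacent-same : ∀ {v w} → B v ≡ true → B w ≡ true → Adj G v w → ℓ v ≡ ℓ w
    adjacent-same Bv Bw vw = Equivalence.to (components _ _ Bv Bw) (step (here Bv) vw Bw)
    connected : ∀ j u v → T j u ≡ true → T j v ≡ true → Reach G (λ v → B v ≡ true) u v
    connected j u v Tu Tv = Equivalence.from (components u v (part-⊆ ℓ B j u Tu) (part-⊆ ℓ B j v Tv))
                                             (trans (part-member ℓ B Tu) (sym (part-member ℓ B Tv)))
    closed : ∀ j v w → T j v ≡ true → B w ≡ true → Adj G v w → T j w ≡ true
    closed j v w Tv Bw vw =
      member-part ℓ B Bw (trans (sym (adjacent-same (part-⊆ ℓ B j v Tv) Bw vw)) (part-member ℓ B Tv))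
    tree : ∀ j → darts (T j) + 2 ≡ 2 * card (T j)
    tree j with a , Ba , ℓa≡j ← nonempty j =
      tree-edges (λ v → B v ≡ true) (T j) (connected j) (closed j)
                 (Forest-mono (part-⊆ ℓ B j) acyclic) (member-part ℓ B Ba ℓa≡j)

  stable-darts : ∀ W → Stable G W → 3 * n ≡ 3 * card W + 3 * card W + darts (not ∘ W)
  stable-darts W stable = begin
    3 * n                                      ≡⟨ cong (3 *_) (trans (sym (*-identityʳ n)) (sym (sum-const n 1))) ⟩
    3 * ∑[ v < n ] 1                           ≡⟨ ∑²-proj₁ (const 1) ⟨
    ∑² (const 1)                               ≡⟨ ∑²-cong (λ d → dart-kinds (W (proj₁ d)) (W (tgt d))) ⟩
    ∑² (λ d → w (proj₁ d) + fromB d + withinB d) ≡⟨ ∑²-+ (λ d → w (proj₁ d) + fromB d) withinB ⟩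
    ∑² (λ d → w (proj₁ d) + fromB d) + darts B ≡⟨ cong (_+ darts B) (∑²-+ (w ∘ proj₁) fromB) ⟩
    ∑² (w ∘ proj₁) + ∑² fromB + darts B        ≡⟨ cong (λ x → ∑² (w ∘ proj₁) + x + darts B) B→W≡W→B ⟩
    ∑² (w ∘ proj₁) + ∑² (w ∘ proj₁) + darts B  ≡⟨ cong (λ x → x + x + darts B) (∑²-proj₁ w) ⟩
    3 * card W + 3 * card W + darts B          ∎
    where
    open ≡-Reasoning
    B : VSet n
    B = not ∘ W
    w b : Fin n → ℕ
    w v = ⟦ W v ⟧
    b v = ⟦ B v ⟧
    fromB fromW withinB : Dart n → ℕ
    fromB d   = b (proj₁ d) * w (tgt d)
    fromW d   = w (proj₁ d) * b (tgt d)
    withinB d = b (proj₁ d) * b (tgt d)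
    dart-kinds : ∀ x y → 1 ≡ ⟦ x ⟧ + ⟦ not x ⟧ * ⟦ y ⟧ + ⟦ not x ⟧ * ⟦ not y ⟧
    dart-kinds true  _     = refl
    dart-kinds false true  = refl
    dart-kinds false false = refl
    W-leaves-to-B : ∀ d → fromW d ≡ w (proj₁ d)
    W-leaves-to-B d@(v , i) with W v in Wv | W (tgt d) in Wt
    ... | false | _     = refl
    ... | true  | false = refl
    ... | true  | true  = ⊥-elim (stable v (tgt d) Wv Wt (i , refl))
    fromB≡fromW∘α : ∀ d → fromB d ≡ fromW (α G d)
    fromB≡fromW∘α d rewrite α-invol G d = *-comm (b (proj₁ d)) (w (tgt d))
    B→W≡W→B : ∑² fromB ≡ ∑² (w ∘ proj₁)
    B→W≡W→B = begin
      ∑² fromB              ≡⟨ ∑²-cong fromB≡fromW∘α ⟩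
      ∑² (fromW ∘ α G)      ≡⟨ ∑²-invol (α G) (α-invol G) fromW ⟩
      ∑² fromW              ≡⟨ ∑²-cong W-leaves-to-B ⟩
      ∑² (w ∘ proj₁)        ∎

  complement-edges : ∀ W ℓ → Forest G (InB G W) → ComponentLabelling G W ℓ →
                     darts (not ∘ W) + 2 * 3 ≡ 2 * card (not ∘ W)
  complement-edges W ℓ acyclic (components , nonempty) =
    forest-edges (not ∘ W) ℓ (Forest-mono (λ _ → not≡true⇒≡false) acyclic)
      (λ u v Bu Bv → let open Equivalence (components u v (not≡true⇒≡false Bu) (not≡true⇒≡false Bv)) in
                     mk⇔ (to ∘ Reach-mono (λ _ → not≡true⇒≡false)) (Reach-mono (λ _ → ≡false⇒not≡true) ∘ from))
      (λ j → map₂ (map₁ ≡false⇒not≡true) (nonempty j))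

lemma3 : ∀ (n : ℕ) (G : CubicMap n) → IsPlane G → (W : Fin n → Bool) → ImproperSTD G W →
    ∃ λ (k : ℕ) → (n + 2 ≡ 4 * k) × (size W ≡ k + 1)
lemma3 n G _ W (stable , acyclic , ℓ , components , _)
  with k , n+2≡4k , ∣W∣≡k+1 ← vertex-count (stable-darts G W stable) (complement-edges G W ℓ acyclic components)
                                           (card-complement W)
  = k , n+2≡4k , trans (size≡sum W) ∣W∣≡k+1
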